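{- There is an absolute constant $C$ such that for every $n\ge 2$ and every simple temporal clique $\mathcal{G}$ on $n$ vertices, every backward fireworks cover of $\mathcal{G}$ has at most $\frac{3}{4}\binom{n}{2}+Cn$ edges.
   Context: A simple temporal clique is a pair $\mathcal{G}=(G,\lambda)$ where $G=(V,E)$ is the complete graph on a finite vertex set $V$ with $n=|V|\ge 2$, and $\lambda:E\to\mathbb{N}$ assigns each edge a single label such that any two distinct edges sharing an endpoint have distinct labels. For a vertex $v$, $e^+(v)$ denotes the edge incident to $v$ with the largest label. Let $E^+$ be the set of arcs on $V$ containing, for each vertex $v$ with $e^+(v)=\{u,v\}$, the arc $(v,u)$, except that whenever $e^+(u)=e^+(v)$ only one of $(u,v),(v,u)$ is included (chosen arbitrarily). A source of $E^+$ is a vertex of in-degree $0$ in $(V,E^+)$. $E^+_T$ is obtained from $E^+$ as follows: for every vertex $v$ of in-degree at least $2$ in $E^+$, let $(u_1,v),\dots,(u_\ell,v)$ be its in-arcs where $(u_\ell,v)$ has the smallest label; for each $i<\ell$, if $u_i$ is a source of $E^+$ replace $(u_i,v)$ by $(v,u_i)$, otherwise delete $(u_i,v)$. The collectors are the vertices of in-degree $0$ in $(V,E^+_T)$. A backward fireworks cover is the edge set $S^+_T=\{\{u,v\}: (u,v)\in E^+_T\}\cup\{\{u,v\}\in E: u\text{ is a collector}\}$, for any of the arbitrary choices above. -}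

module Defs where

open import Data.Nat using (ℕ; _<_; _+_)
open import Data.Nat.Base using (_<ᵇ_)
open import Data.Bool using (Bool; true; false; _∧_; if_then_else_)
open import Data.Fin using (Fin; toℕ)
open import Data.List using (List; map; allFin)
open import Data.Nat.ListAction using (sum)
open import Data.Product using (Σ; _×_)
open import Data.Sum using (_⊎_)
open import Relation.Nullary using (¬_)
open import Relation.Binary.PropositionalEquality using (_≡_; _≢_)
open import Function.Bundles using (_⇔_)

-- Edge labelling of the complete graph on Fin n, given as a function on
-- ordered pairs; only values at u ≢ v are meaningful (required symmetric).
Labelling : ℕ → Set
Labelling n = Fin n → Fin n → ℕ

IsSimpleTemporalClique : ∀ {n} → Labelling n → Set
IsSimpleTemporalClique {n} lab =
  (∀ (u v : Fin n) → lab u v ≡ lab v u) ×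
  (∀ (u v w : Fin n) → u ≢ v → u ≢ w → v ≢ w → lab u v ≢ lab u w)

IsTop : ∀ {n} → Labelling n → Fin n → Fin n → Set
IsTop {n} lab v u = (u ≢ v) × (∀ (w : Fin n) → w ≢ v → w ≢ u → lab v w < lab v u)

Arcs : ℕ → Set
Arcs n = Fin n → Fin n → Bool

-- A is a valid choice of E⁺.
IsEPlus : ∀ {n} → Labelling n → Arcs n → Set
IsEPlus {n} lab A =
  (∀ (v u : Fin n) → A v u ≡ true → IsTop lab v u) ×
  (∀ (v u : Fin n) → IsTop lab v u → ¬ IsTop lab u v → A v u ≡ true) ×
  (∀ (v u : Fin n) → IsTop lab v u → IsTop lab u v →
     (A v u ≡ true ⊎ A u v ≡ true) × ¬ (A v u ≡ true × A u v ≡ true))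

IsSource : ∀ {n} → Arcs n → Fin n → Set
IsSource {n} A s = ∀ (w : Fin n) → A w s ≢ true

InDeg≥2 : ∀ {n} → Arcs n → Fin n → Set
InDeg≥2 {n} A v = Σ (Fin n) λ a → Σ (Fin n) λ b → (a ≢ b) × (A a v ≡ true) × (A b v ≡ true)

IsMinIn : ∀ {n} → Labelling n → Arcs n → Fin n → Fin n → Set
IsMinIn {n} lab A u v =
  (A u v ≡ true) × (∀ (w : Fin n) → w ≢ u → A w v ≡ true → lab u v < lab w v)

InET : ∀ {n} → Labelling n → Arcs n → Fin n → Fin n → Set
InET lab A x y =
  -- arcs of E⁺ that are untouched
  (A x y ≡ true × (InDeg≥2 A y → IsMinIn lab A x y))
  ⊎
  -- reversed arcs: (y,x) ∈ E⁺, x has in-degree ≥ 2, y not the smallest, y a source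
  (A y x ≡ true × InDeg≥2 A x × ¬ IsMinIn lab A y x × IsSource A y)

IsCollector : ∀ {n} → Labelling n → Arcs n → Fin n → Set
IsCollector {n} lab A c = ∀ (w : Fin n) → ¬ InET lab A w c

InCover : ∀ {n} → Labelling n → Arcs n → Fin n → Fin n → Set
InCover lab A u v =
  InET lab A u v ⊎ InET lab A v u ⊎ IsCollector lab A u ⊎ IsCollector lab A v

IsBackwardFireworksCover : ∀ {n} → Labelling n → (Fin n → Fin n → Bool) → Set
IsBackwardFireworksCover {n} lab S =
  Σ (Arcs n) λ A → IsEPlus lab A ×
    (∀ (u v : Fin n) → u ≢ v → (S u v ≡ true ⇔ InCover lab A u v))

edgeCount : ∀ {n} → (Fin n → Fin n → Bool) → ℕ
edgeCount {n} S =
  sum (map (λ i → sum (map (λ j → if (toℕ i <ᵇ toℕ j) ∧ S i j then 1 else 0)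
                          (allFin n)))
           (allFin n))

module Submission where

-- Let k be the number of collectors and x the indicator of the collectors. Every edge of S⁺_T
-- meets a collector or is an arc of E⁺, and E⁺ has out-degree at most one, hence at most n arcs.
-- Summing the inequality  [ij ∈ S] + [ji ∈ S] + xᵢxⱼ ≤ (xᵢ + [ij ∈ E⁺]) + (xⱼ + [ji ∈ E⁺])
-- over all ordered pairs (i, j) gives 2|S| + k² ≤ 2(nk + n). Collectors are sources of E⁺ and
-- each sends its arc of E⁺ to a different non-collector, so 2k ≤ n; on that range 2nk − k² is at
-- most 3n²/4, whence 4|S| ≤ 3·C(n,2) + 8n.

open import Defs
open import Data.Nat using (ℕ; zero; suc; _≤_; _<_; _*_; _+_; z≤n; s≤s; _<ᵇ_; _<?_)
open import Data.Nat.Properties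
  using ( ≤-trans; ≤-reflexive; <-irrefl; <-asym; ≤∧≢⇒<; <ᵇ⇒<; m≤m+n; m≤n+m; m≤n⇒∃[o]m+o≡n
        ; +-identityʳ; *-identityʳ; +-mono-≤; +-monoˡ-≤; +-monoʳ-≤; *-monoʳ-≤
        ; +-cancelʳ-≤; *-cancelˡ-≤; +-*-semiring; module ≤-Reasoning)
open import Data.Nat.Combinatorics using (_C_; nCk+nC[k+1]≡[n+1]C[k+1]; nC1≡n)
open import Data.Nat.Tactic.RingSolver using (solve-∀)
import Data.Nat.ListAction as List
open import Data.Fin using (Fin; zero; suc; toℕ)
import Data.Fin.Properties as Fin
open import Data.Fin.Properties using (_≟_; any?; all?)
open import Data.List using (List; map; allFin; tabulate; filter)
open import Data.List.Properties using (map-tabulate)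
open import Data.List.Extrema.Nat using (argmax; argmin; argmax-all; argmin-all; f[xs]≤f[argmax]; f[argmin]≤f[xs])
import Data.List.Relation.Unary.All as All
open import Data.List.Relation.Unary.All.Properties using (all-filter)
open import Data.List.Membership.Propositional.Properties using (∈-filter⁺; ∈-allFin)
open import Data.Bool using (Bool; true; false; _∧_; if_then_else_)
import Data.Bool.Properties as Bool
open import Data.Product using (∃-syntax; _×_; _,_; proj₁; proj₂)
open import Data.Sum using (_⊎_; inj₁; inj₂)
import Data.Sum as Sum
open import Data.Empty using (⊥-elim)
open import Function using (_∘_; id)
open import Function.Bundles using (Equivalence)
open import Level using (Level)
open import Relation.Nullary using (¬_; Dec; yes; no; does)
open import Relation.Nullary.Decidable using (decidable-stable; dec-true; _×-dec_; _⊎-dec_; _→-dec_; ¬?)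
open import Relation.Unary using (Pred; Decidable)
open import Relation.Binary.PropositionalEquality
open import Algebra.Properties.Semiring.Sum +-*-semiring
  using (sum; sum-syntax; sum-cong-≗; ∑-distrib-+; ∑-comm; *-distribˡ-sum; *-distribʳ-sum)

private
  variable
    p : Level
    n : ℕ

sum-map-allFin : (f : Fin n → ℕ) → List.sum (map f (allFin n)) ≡ sum f
sum-map-allFin f = trans (cong List.sum (map-tabulate id f)) (sum-tabulate f)
  where
  sum-tabulate : ∀ {n} (f : Fin n → ℕ) → List.sum (tabulate f) ≡ sum f
  sum-tabulate {zero} f = refl
  sum-tabulate {suc n} f = cong (f zero +_) (sum-tabulate (f ∘ suc))

∑-mono-≤ : {f g : Fin n → ℕ} → (∀ i → f i ≤ g i) → sum f ≤ sum g
∑-mono-≤ {zero} _ = z≤n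
∑-mono-≤ {suc n} f≤g = +-mono-≤ (f≤g zero) (∑-mono-≤ (f≤g ∘ suc))

∑-const : ∀ n c → ∑[ i < n ] c ≡ n * c
∑-const zero c = refl
∑-const (suc n) c = cong (c +_) (∑-const n c)

term≤∑ : (f : Fin n → ℕ) (i : Fin n) → f i ≤ sum f
term≤∑ f zero = m≤m+n _ _
term≤∑ f (suc i) = ≤-trans (term≤∑ (f ∘ suc) i) (m≤n+m _ (f zero))

𝟙 : Bool → ℕ
𝟙 b = if b then 1 else 0

∑𝟙-none : (b : Fin n → Bool) → (∀ i → b i ≢ true) → sum (𝟙 ∘ b) ≡ 0
∑𝟙-none {zero} b none = refl
∑𝟙-none {suc n} b none with b zero in b₀
... | true = ⊥-elim (none zero b₀)
... | false = ∑𝟙-none (b ∘ suc) (none ∘ suc)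

∑𝟙-≤1 : (b : Fin n → Bool) → (∀ {i j} → b i ≡ true → b j ≡ true → i ≡ j) → sum (𝟙 ∘ b) ≤ 1
∑𝟙-≤1 {zero} b unique = z≤n
∑𝟙-≤1 {suc n} b unique with b zero in b₀
... | true = ≤-reflexive (cong suc (∑𝟙-none (b ∘ suc) (λ i bᵢ → Fin.0≢1+n (unique b₀ bᵢ))))
... | false = ∑𝟙-≤1 (b ∘ suc) (λ bᵢ bⱼ → Fin.suc-injective (unique bᵢ bⱼ))

count : {P : Pred (Fin n) p} → Decidable P → ℕ
count P? = sum (λ i → 𝟙 (does (P? i)))

∑∑ : (Fin n → Fin n → ℕ) → ℕ
∑∑ {n} f = ∑[ i < n ] ∑[ j < n ] f i j

∑∑-distrib-+ : (f g : Fin n → Fin n → ℕ) → ∑∑ (λ i j → f i j + g i j) ≡ ∑∑ f + ∑∑ g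
∑∑-distrib-+ {n} f g = trans (sum-cong-≗ (λ i → ∑-distrib-+ (f i) (g i)))
  (∑-distrib-+ (λ i → ∑[ j < n ] f i j) (λ i → ∑[ j < n ] g i j))

∑∑-transpose : (f : Fin n → Fin n → ℕ) → ∑∑ (λ i j → f j i) ≡ ∑∑ f
∑∑-transpose f = sym (∑-comm f)

∑∑-symmetrise : (f : Fin n → Fin n → ℕ) → ∑∑ (λ i j → f i j + f j i) ≡ 2 * ∑∑ f
∑∑-symmetrise f = begin
  ∑∑ (λ i j → f i j + f j i)   ≡⟨ ∑∑-distrib-+ f (λ i j → f j i) ⟩
  ∑∑ f + ∑∑ (λ i j → f j i)    ≡⟨ cong (∑∑ f +_) (trans (∑∑-transpose f) (sym (+-identityʳ (∑∑ f)))) ⟩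
  2 * ∑∑ f                     ∎
  where open ≡-Reasoning

∑∑-product : (x y : Fin n → ℕ) → ∑∑ (λ i j → x i * y j) ≡ sum x * sum y
∑∑-product x y = trans (sum-cong-≗ (λ i → sym (*-distribˡ-sum (x i) y))) (sym (*-distribʳ-sum (sum y) x))

∑∑-row-const : (x : Fin n → ℕ) → ∑∑ (λ i j → x i) ≡ n * sum x
∑∑-row-const {n} x = trans (sum-cong-≗ (λ i → ∑-const n (x i))) (sym (*-distribˡ-sum n x))

∑∑-functional≤n : (A : Fin n → Fin n → Bool) → (∀ {i j j′} → A i j ≡ true → A i j′ ≡ true → j ≡ j′) →
  ∑∑ (λ i j → 𝟙 (A i j)) ≤ n
∑∑-functional≤n {n} A functional = begin
  ∑∑ (λ i j → 𝟙 (A i j))   ≤⟨ ∑-mono-≤ (λ i → ∑𝟙-≤1 (A i) functional) ⟩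
  ∑[ i < n ] 1             ≡⟨ trans (∑-const n 1) (*-identityʳ n) ⟩
  n                        ∎
  where open ≤-Reasoning

edgeCount≡∑∑ : (S : Fin n → Fin n → Bool) → edgeCount S ≡ ∑∑ (λ i j → 𝟙 ((toℕ i <ᵇ toℕ j) ∧ S i j))
edgeCount≡∑∑ {n} S = trans (sum-map-allFin (λ i → List.sum (map (e i) (allFin n)))) (sum-cong-≗ (λ i → sum-map-allFin (e i)))
  where
  e : Fin n → Fin n → ℕ
  e i j = 𝟙 ((toℕ i <ᵇ toℕ j) ∧ S i j)

𝟙-cover-bound : ∀ s x y a b → (s ≡ true → x ≡ true ⊎ y ≡ true ⊎ a ≡ true ⊎ b ≡ true) →
  𝟙 s + 𝟙 x * 𝟙 y ≤ (𝟙 x + 𝟙 a) + (𝟙 y + 𝟙 b)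
𝟙-cover-bound false false y     a     b     _ = z≤n
𝟙-cover-bound false true  false a     b     _ = z≤n
𝟙-cover-bound false true  true  a     b     _ = s≤s z≤n
𝟙-cover-bound true  true  true  true  b     _ = s≤s (s≤s z≤n)
𝟙-cover-bound true  true  true  false b     _ = s≤s (s≤s z≤n)
𝟙-cover-bound true  true  false a     b     _ = s≤s z≤n
𝟙-cover-bound true  false true  true  b     _ = s≤s z≤n
𝟙-cover-bound true  false true  false b     _ = s≤s z≤n
𝟙-cover-bound true  false false true  b     _ = s≤s z≤n
𝟙-cover-bound true  false false false true  _ = s≤s z≤n
𝟙-cover-bound true  false false false false covered with covered refl
... | inj₁ ()
... | inj₂ (inj₁ ())
... | inj₂ (inj₂ (inj₁ ()))
... | inj₂ (inj₂ (inj₂ ()))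

<ᵇ-true⇒< : ∀ u v → (u <ᵇ v) ≡ true → u < v
<ᵇ-true⇒< u v u<v = <ᵇ⇒< u v (Equivalence.from Bool.T-≡ u<v)

module _ {K : Pred (Fin n) p} (K? : Decidable K) (A : Fin n → Fin n → Bool) where

  injection-into-complement⇒2*count≤n :
    (∀ {c} → K c → ∃[ u ] A c u ≡ true) →
    (∀ {c c′ u} → K c → K c′ → A c u ≡ true → A c′ u ≡ true → c ≡ c′) →
    (∀ {c u} → K u → A c u ≢ true) →
    2 * count K? ≤ n
  injection-into-complement⇒2*count≤n out injective outside = begin
      2 * count K?
    ≡⟨ cong (count K? +_) (+-identityʳ (count K?)) ⟩
      count K? + count K?
    ≤⟨ +-monoˡ-≤ (count K?) (∑-mono-≤ marked-has-out) ⟩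
      ∑∑ (λ c u → 𝟙 (R c u)) + count K?
    ≡⟨ cong (_+ count K?) (∑∑-transpose (λ u c → 𝟙 (R c u))) ⟩
      ∑[ u < n ] ∑[ c < n ] 𝟙 (R c u) + count K?
    ≡⟨ ∑-distrib-+ (λ u → ∑[ c < n ] 𝟙 (R c u)) (λ u → 𝟙 (does (K? u))) ⟨
      ∑[ u < n ] (∑[ c < n ] 𝟙 (R c u) + 𝟙 (does (K? u)))
    ≤⟨ ∑-mono-≤ hit-at-most-once ⟩
      ∑[ u < n ] 1
    ≡⟨ trans (∑-const n 1) (*-identityʳ n) ⟩
      n ∎
    where
    open ≤-Reasoning

    R : Fin n → Fin n → Bool
    R c u = does (K? c) ∧ A c u

    R⇒K×A : ∀ {c u} → R c u ≡ true → K c × A c u ≡ true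
    R⇒K×A {c} r with K? c | r
    ... | yes k | a = k , a

    marked-has-out : ∀ c → 𝟙 (does (K? c)) ≤ ∑[ u < n ] 𝟙 (R c u)
    marked-has-out c with K? c
    ... | no _ = z≤n
    ... | yes k with out k
    ...   | u , a = ≤-trans (≤-reflexive (cong 𝟙 (sym a))) (term≤∑ (𝟙 ∘ A c) u)

    hit-at-most-once : ∀ u → ∑[ c < n ] 𝟙 (R c u) + 𝟙 (does (K? u)) ≤ 1
    hit-at-most-once u with K? u
    ... | yes k = ≤-reflexive (cong (_+ 1) (∑𝟙-none (λ c → R c u) (λ c r → outside k (proj₂ (R⇒K×A r)))))
    ... | no _ = ≤-trans (≤-reflexive (+-identityʳ _)) (∑𝟙-≤1 (λ c → R c u) λ r r′ →
            injective (proj₁ (R⇒K×A r)) (proj₁ (R⇒K×A r′)) (proj₂ (R⇒K×A r)) (proj₂ (R⇒K×A r′)))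

  module _ (S : Fin n → Fin n → Bool)
           (cover : ∀ {i j} → i ≢ j → S i j ≡ true → K i ⊎ K j ⊎ A i j ≡ true ⊎ A j i ≡ true) where

    private
      x : Fin n → ℕ
      x i = 𝟙 (does (K? i))

      e : Fin n → Fin n → ℕ
      e i j = 𝟙 ((toℕ i <ᵇ toℕ j) ∧ S i j)

      covered : ∀ {i j} → i ≢ j → S i j ≡ true →
        does (K? i) ≡ true ⊎ does (K? j) ≡ true ⊎ A i j ≡ true ⊎ A j i ≡ true
      covered {i} {j} i≢j s = Sum.map (dec-true (K? i)) (Sum.map₁ (dec-true (K? j))) (cover i≢j s)

      swap-ends : ∀ {P Q R U : Set} → P ⊎ Q ⊎ R ⊎ U → Q ⊎ P ⊎ U ⊎ R
      swap-ends (inj₁ p) = inj₂ (inj₁ p)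
      swap-ends (inj₂ (inj₁ q)) = inj₁ q
      swap-ends (inj₂ (inj₂ (inj₁ r))) = inj₂ (inj₂ (inj₂ r))
      swap-ends (inj₂ (inj₂ (inj₂ u))) = inj₂ (inj₂ (inj₁ u))

      <ᵇ⇒≢ : (i j : Fin n) → (toℕ i <ᵇ toℕ j) ≡ true → i ≢ j
      <ᵇ⇒≢ i j i<j i≡j = <-irrefl (cong toℕ i≡j) (<ᵇ-true⇒< (toℕ i) (toℕ j) i<j)

    pair-bound : (i j : Fin n) → e i j + e j i + x i * x j ≤ (x i + 𝟙 (A i j)) + (x j + 𝟙 (A j i))
    pair-bound i j with toℕ i <ᵇ toℕ j in i<j | toℕ j <ᵇ toℕ i in j<i
    ... | true  | true  = ⊥-elim (<-asym (<ᵇ-true⇒< (toℕ i) (toℕ j) i<j) (<ᵇ-true⇒< (toℕ j) (toℕ i) j<i))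
    ... | false | false = 𝟙-cover-bound false (does (K? i)) (does (K? j)) (A i j) (A j i) λ ()
    ... | true  | false = ≤-trans (≤-reflexive (cong (_+ x i * x j) (+-identityʳ (𝟙 (S i j)))))
      (𝟙-cover-bound (S i j) (does (K? i)) (does (K? j)) (A i j) (A j i) (covered (<ᵇ⇒≢ i j i<j)))
    ... | false | true  =
      𝟙-cover-bound (S j i) (does (K? i)) (does (K? j)) (A i j) (A j i) (swap-ends ∘ covered (<ᵇ⇒≢ j i j<i))

    covered-edgeCount-bound : (∀ {i j j′} → A i j ≡ true → A i j′ ≡ true → j ≡ j′) →
      2 * edgeCount S + count K? * count K? ≤ 2 * (n * count K? + n)
    covered-edgeCount-bound functional = begin
        2 * edgeCount S + count K? * count K?
      ≡⟨ cong₂ _+_ (cong (2 *_) (edgeCount≡∑∑ S)) (sym (∑∑-product x x)) ⟩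
        2 * ∑∑ e + ∑∑ (λ i j → x i * x j)
      ≡⟨ cong (_+ ∑∑ (λ i j → x i * x j)) (∑∑-symmetrise e) ⟨
        ∑∑ (λ i j → e i j + e j i) + ∑∑ (λ i j → x i * x j)
      ≡⟨ ∑∑-distrib-+ (λ i j → e i j + e j i) (λ i j → x i * x j) ⟨
        ∑∑ (λ i j → e i j + e j i + x i * x j)
      ≤⟨ ∑-mono-≤ (λ i → ∑-mono-≤ (pair-bound i)) ⟩
        ∑∑ (λ i j → (x i + 𝟙 (A i j)) + (x j + 𝟙 (A j i)))
      ≡⟨ ∑∑-symmetrise (λ i j → x i + 𝟙 (A i j)) ⟩
        2 * ∑∑ (λ i j → x i + 𝟙 (A i j))
      ≡⟨ cong (2 *_) (trans (∑∑-distrib-+ (λ i j → x i) (λ i j → 𝟙 (A i j))) (cong (_+ _) (∑∑-row-const x))) ⟩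
        2 * (n * count K? + ∑∑ (λ i j → 𝟙 (A i j)))
      ≤⟨ *-monoʳ-≤ 2 (+-monoʳ-≤ (n * count K?) (∑∑-functional≤n A functional)) ⟩
        2 * (n * count K? + n) ∎
      where open ≤-Reasoning

2*nC2+n≡n*n : ∀ n → 2 * (n C 2) + n ≡ n * n
2*nC2+n≡n*n zero = refl
2*nC2+n≡n*n (suc n) = begin
    2 * (suc n C 2) + suc n
  ≡⟨ cong (λ c → 2 * c + suc n) (nCk+nC[k+1]≡[n+1]C[k+1] n 1) ⟨
    2 * (n C 1 + n C 2) + suc n
  ≡⟨ cong (λ c → 2 * (c + n C 2) + suc n) (nC1≡n n) ⟩
    2 * (n + n C 2) + suc n
  ≡⟨ regroup n (n C 2) ⟩
    (2 * (n C 2) + n) + (2 * n + 1)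
  ≡⟨ cong (_+ (2 * n + 1)) (2*nC2+n≡n*n n) ⟩
    n * n + (2 * n + 1)
  ≡⟨ square-suc n ⟩
    suc n * suc n ∎
  where
  open ≡-Reasoning
  regroup : ∀ n c → 2 * (n + c) + suc n ≡ (2 * c + n) + (2 * n + 1)
  regroup = solve-∀
  square-suc : ∀ n → n * n + (2 * n + 1) ≡ suc n * suc n
  square-suc = solve-∀

-- Writing n = 2k + m, the slack 4km + 3m² + 5n is where 2k ≤ n enters: 3n² − 8nk + 4k² = m(3m + 4k).
three-quarters-bound : ∀ n k e → 2 * e + k * k ≤ 2 * (n * k + n) → 2 * k ≤ n →
  4 * e ≤ 3 * (n C 2) + 8 * n
three-quarters-bound n k e counted 2k≤n with m , refl ← m≤n⇒∃[o]m+o≡n 2k≤n =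
  *-cancelˡ-≤ 2 (+-cancelʳ-≤ (4 * (k * k)) (2 * (4 * e)) (2 * (3 * (n C 2) + 8 * n)) (begin
    2 * (4 * e) + 4 * (k * k)
  ≡⟨ factor-4 k e ⟩
    4 * (2 * e + k * k)
  ≤⟨ *-monoʳ-≤ 4 counted ⟩
    4 * (2 * (n * k + n))
  ≤⟨ m≤m+n _ (4 * k * m + 3 * (m * m) + 5 * n) ⟩
    4 * (2 * (n * k + n)) + (4 * k * m + 3 * (m * m) + 5 * n)
  ≡⟨ slack k m ⟩
    3 * (n * n) + 13 * n + 4 * (k * k)
  ≡⟨ cong (λ s → 3 * s + 13 * n + 4 * (k * k)) (2*nC2+n≡n*n n) ⟨
    3 * (2 * (n C 2) + n) + 13 * n + 4 * (k * k)
  ≡⟨ factor-2 (n C 2) n k ⟩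
    2 * (3 * (n C 2) + 8 * n) + 4 * (k * k) ∎))
  where
  open ≤-Reasoning
  factor-4 : ∀ k e → 2 * (4 * e) + 4 * (k * k) ≡ 4 * (2 * e + k * k)
  factor-4 = solve-∀
  slack : ∀ k m → let n = 2 * k + m in
    4 * (2 * (n * k + n)) + (4 * k * m + 3 * (m * m) + 5 * n) ≡ 3 * (n * n) + 13 * n + 4 * (k * k)
  slack = solve-∀
  factor-2 : ∀ c n k → 3 * (2 * c + n) + 13 * n + 4 * (k * k) ≡ 2 * (3 * c + 8 * n) + 4 * (k * k)
  factor-2 = solve-∀

module _ {P : Pred (Fin n) p} (P? : Decidable P) (f : Fin n → ℕ) where

  maximiser : ∃[ w ] P w → ∃[ u ] P u × (∀ {w} → P w → f w ≤ f u)
  maximiser (w₀ , pw₀) =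
    u , argmax-all f pw₀ (all-filter P? (allFin n)) ,
    λ pw → All.lookup (f[xs]≤f[argmax] w₀ candidates) (∈-filter⁺ P? (∈-allFin _) pw)
    where
    candidates : List (Fin n)
    candidates = filter P? (allFin n)
    u : Fin n
    u = argmax f w₀ candidates

  minimiser : ∃[ w ] P w → ∃[ u ] P u × (∀ {w} → P w → f u ≤ f w)
  minimiser (w₀ , pw₀) =
    u , argmin-all f pw₀ (all-filter P? (allFin n)) ,
    λ pw → All.lookup (f[argmin]≤f[xs] w₀ candidates) (∈-filter⁺ P? (∈-allFin _) pw)
    where
    candidates : List (Fin n)
    candidates = filter P? (allFin n)
    u : Fin n
    u = argmin f w₀ candidates

module _ (lab : Labelling n) (A : Arcs n) where

  inDeg≥2? : Decidable (InDeg≥2 A)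
  inDeg≥2? v = any? λ a → any? λ b → ¬? (a ≟ b) ×-dec (A a v Bool.≟ true) ×-dec (A b v Bool.≟ true)

  isMinIn? : ∀ u v → Dec (IsMinIn lab A u v)
  isMinIn? u v = (A u v Bool.≟ true) ×-dec
    all? (λ w → ¬? (w ≟ u) →-dec (A w v Bool.≟ true) →-dec (lab u v <? lab w v))

  isSource? : Decidable (IsSource A)
  isSource? s = all? λ w → ¬? (A w s Bool.≟ true)

  inET? : ∀ x y → Dec (InET lab A x y)
  inET? x y =
    ((A x y Bool.≟ true) ×-dec (inDeg≥2? y →-dec isMinIn? x y)) ⊎-dec
    ((A y x Bool.≟ true) ×-dec inDeg≥2? x ×-dec ¬? (isMinIn? y x) ×-dec isSource? y)

  collector? : Decidable (IsCollector lab A)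
  collector? c = all? λ w → ¬? (inET? w c)

  ET⇒arc : ∀ {x y} → InET lab A x y → A x y ≡ true ⊎ A y x ≡ true
  ET⇒arc (inj₁ (a , _)) = inj₁ a
  ET⇒arc (inj₂ (a , _)) = inj₂ a

  cover-edge : ∀ {u v} → InCover lab A u v →
    IsCollector lab A u ⊎ IsCollector lab A v ⊎ A u v ≡ true ⊎ A v u ≡ true
  cover-edge (inj₁ et) = inj₂ (inj₂ (ET⇒arc et))
  cover-edge (inj₂ (inj₁ et)) = inj₂ (inj₂ (Sum.swap (ET⇒arc et)))
  cover-edge (inj₂ (inj₂ (inj₁ col))) = inj₁ col
  cover-edge (inj₂ (inj₂ (inj₂ col))) = inj₂ (inj₁ col)

  minIn-unique : ∀ {a b v} → IsMinIn lab A a v → IsMinIn lab A b v → a ≡ b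
  minIn-unique {a} {b} (Aav , a-min) (Abv , b-min) = decidable-stable (a ≟ b) λ a≢b →
    <-asym (a-min b (≢-sym a≢b) Abv) (b-min a a≢b Aav)

top-unique : (lab : Labelling n) → ∀ {v u u′} → IsTop lab v u → IsTop lab v u′ → u ≡ u′
top-unique lab {u = u} {u′} (u≢v , u-max) (u′≢v , u′-max) = decidable-stable (u ≟ u′) λ u≢u′ →
  <-asym (u-max u′ u′≢v (≢-sym u≢u′)) (u′-max u u≢v u≢u′)

module _ {lab : Labelling n} (clique : IsSimpleTemporalClique lab) where

  private
    lab-sym : ∀ u v → lab u v ≡ lab v u
    lab-sym = proj₁ clique
    lab-proper : ∀ u v w → u ≢ v → u ≢ w → v ≢ w → lab u v ≢ lab u w
    lab-proper = proj₂ clique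

  top-exists : ∀ {v} → ∃[ w ] w ≢ v → ∃[ u ] IsTop lab v u
  top-exists {v} other with u , u≢v , maximal ← maximiser (λ w → ¬? (w ≟ v)) (lab v) other =
    u , u≢v , λ w w≢v w≢u → ≤∧≢⇒< (maximal w≢v) (lab-proper v w u (≢-sym w≢v) (≢-sym u≢v) w≢u)

  module _ {A : Arcs n} (E⁺ : IsEPlus lab A) where

    private
      arc⇒top : ∀ v u → A v u ≡ true → IsTop lab v u
      arc⇒top = proj₁ E⁺
      top⇒arc : ∀ v u → IsTop lab v u → ¬ IsTop lab u v → A v u ≡ true
      top⇒arc = proj₁ (proj₂ E⁺)
      mutual-top : ∀ v u → IsTop lab v u → IsTop lab u v → A v u ≡ true ⊎ A u v ≡ true
      mutual-top v u top top′ = proj₁ (proj₂ (proj₂ E⁺) v u top top′)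

    out-functional : ∀ {v u u′} → A v u ≡ true → A v u′ ≡ true → u ≡ u′
    out-functional a a′ = top-unique lab (arc⇒top _ _ a) (arc⇒top _ _ a′)

    in-labels-distinct : ∀ {a b v} → A a v ≡ true → A b v ≡ true → a ≢ b → lab a v ≢ lab b v
    in-labels-distinct {a} {b} {v} Aav Abv a≢b same =
      lab-proper v a b (proj₁ (arc⇒top a v Aav)) (proj₁ (arc⇒top b v Abv)) a≢b
        (trans (lab-sym v a) (trans same (lab-sym b v)))

    -- The in-arc of c with the smallest label is never deleted or reversed in E⁺_T.
    collector⇒source : ∀ {c} → IsCollector lab A c → IsSource A c
    collector⇒source {c} col w Awc
      with m , Amc , minimal ← minimiser (λ w → A w c Bool.≟ true) (λ w → lab w c) (w , Awc) =
      col m (inj₁ (Amc , λ _ → Amc , λ w′ w′≢m Aw′c →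
        ≤∧≢⇒< (minimal Aw′c) (in-labels-distinct Amc Aw′c (≢-sym w′≢m))))

    collector-out-arc : ∀ {c} → ∃[ w ] w ≢ c → IsCollector lab A c → ∃[ u ] A c u ≡ true
    collector-out-arc {c} other col with u , top ← top-exists other with A c u Bool.≟ true
    ... | yes Acu = u , Acu
    ... | no ¬Acu = ⊥-elim (¬Acu (top⇒arc c u top not-mutual))
      where
      not-mutual : ¬ IsTop lab u c
      not-mutual top′ = Sum.[ ¬Acu , collector⇒source col u ]′ (mutual-top c u top top′)

    collector-arc-minimal : ∀ {c u} → IsCollector lab A c → A c u ≡ true → InDeg≥2 A u →
      ¬ ¬ IsMinIn lab A c u
    collector-arc-minimal {u = u} col Acu indeg ¬min =
      col u (inj₂ (Acu , indeg , ¬min , collector⇒source col))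

    collector-arcs-injective : ∀ {c c′ u} → IsCollector lab A c → IsCollector lab A c′ →
      A c u ≡ true → A c′ u ≡ true → c ≡ c′
    collector-arcs-injective {c} {c′} col col′ Acu Ac′u = decidable-stable (c ≟ c′) λ c≢c′ →
      let indeg = c , c′ , c≢c′ , Acu , Ac′u in
      collector-arc-minimal col Acu indeg λ c-min →
      collector-arc-minimal col′ Ac′u indeg λ c′-min →
      c≢c′ (minIn-unique lab A c-min c′-min)

another-vertex : 2 ≤ n → (v : Fin n) → ∃[ w ] w ≢ v
another-vertex (s≤s (s≤s _)) zero = suc zero , λ ()
another-vertex (s≤s (s≤s _)) (suc v) = zero , λ ()

theorem5 : ∃[ c ] ∀ (n : ℕ) → 2 ≤ n → (lab : Labelling n) → IsSimpleTemporalClique lab →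
    (S : Fin n → Fin n → Bool) → IsBackwardFireworksCover lab S →
    4 * edgeCount S ≤ 3 * (n C 2) + 4 * c * n
theorem5 = 2 , λ n 2≤n lab clique S (A , E⁺ , S⇔cover) →
  let coll? = collector? lab A in
  three-quarters-bound n (count coll?) (edgeCount S)
    (covered-edgeCount-bound coll? A S
      (λ i≢j s → cover-edge lab A (Equivalence.to (S⇔cover _ _ i≢j) s))
      (out-functional clique E⁺))
    (injection-into-complement⇒2*count≤n coll? A
      (collector-out-arc clique E⁺ (another-vertex 2≤n _))
      (collector-arcs-injective clique E⁺)
      (λ col → collector⇒source clique E⁺ col _))
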